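{- Let $a_1,\dots,a_r$ be positive integers with sum $n$, $\Pi=\Pi(a_1,\dots,a_r)$, and suppose $\Delta_{\Pi,2}$ has dimension $d$. Then the map sending a simplex with vertex set $\{\epsilon_I: I\in E\}$ to the graph on $[n]$ with edge set $E$ is a bijection between the maximal (i.e. $d$-dimensional) simplices of the triangulation of $\Delta_{\Pi,2}$ induced by $\Gamma_{2,n}$ and the thrackles on $[n]$ with $d+1$ edges all of whose edges are bases of $\mathcal M_{\Pi,2}$.
   Context: $\Pi(a_1,\dots,a_r)$ is the partition of $[n]$ into consecutive blocks $\pi_1=\{1,\dots,a_1\}$, ..., $\pi_r=\{a_1+\dots+a_{r-1}+1,\dots,n\}$. $\mathcal M_{\Pi,2}$ is the collection (matroid) of 2-subsets $I\subseteq[n]$ with $|I\cap\pi_j|\le1$ for all $j$ (its elements are called bases), and $\Delta_{\Pi,2}=\mathrm{conv}\{\epsilon_I: I\in\mathcal M_{\Pi,2}\}$, with $\epsilon_I$ the 0/1 indicator vector of $I$. For 2-subsets $I,J$ with $(a'_1,\dots,a'_4)$ the nondecreasing ordering of their multiset union, $U(I,J)=\{a'_1,a'_3\}$, $V(I,J)=\{a'_2,a'_4\}$; $(I,J)$ is sorted if $I=U$, $J=V$; a collection is sorted if all pairs $(I_i,I_j)$, $i<j$, are sorted. $\Gamma_{2,n}$ is the triangulation of the hypersimplex $\mathrm{conv}\{\epsilon_I:|I|=2\}$ into the simplices $\mathrm{conv}\{\epsilon_{I_1},\dots,\epsilon_{I_r}\}$ for sorted collections $(I_1,\dots,I_r)$;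 the simplices of $\Gamma_{2,n}$ contained in $\Delta_{\Pi,2}$ form a triangulation of it. A graph on $[n]$ is drawn with vertices on a circle labelled clockwise in increasing order and edges as chords; a thrackle is such a graph in which every pair of edges intersects (sharing an endpoint counts as intersecting). -}

module Defs where

open import Level using (0ℓ)
open import Data.Nat using (ℕ; zero; suc; _≤_; _<_)
open import Data.Fin using (Fin; toℕ)
open import Data.List using (List; []; _∷_; length; take)
open import Data.Nat.ListAction using (sum)
open import Data.List.Membership.Propositional using (_∈_)
open import Data.List.Relation.Unary.All using (All)
open import Data.List.Relation.Unary.AllPairs using (AllPairs)
open import Data.List.Relation.Unary.Unique.Propositional using (Unique)
open import Data.List.Relation.Binary.Permutation.Propositional using (_↭_)
open import Data.Rational using (ℚ; 0ℚ; 1ℚ; _+_; _*_)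
open import Data.Product using (Σ; ∃; ∃-syntax; _×_; _,_; proj₁; proj₂)
open import Data.Sum using (_⊎_)
open import Relation.Nullary using (¬_)
open import Relation.Binary.PropositionalEquality using (_≡_)
open import Function.Bundles using (_⇔_)

-- Ground set [n] is modelled by Fin n (element x : Fin n stands for
-- toℕ x + 1); the order is the natural order.

-- A 2-subset {i , j} of [n] is represented canonically by the ordered
-- pair (i , j) with i < j (see Is2Subset).
Pair : ℕ → Set
Pair n = Fin n × Fin n

fst snd : ∀ {n} → Pair n → ℕ
fst (i , j) = toℕ i
snd (i , j) = toℕ j

Is2Subset : ∀ {n} → Pair n → Set
Is2Subset I = fst I < snd I

-- Block j (0-indexed, j < r) is { x | a₁+…+a_j ≤ x < a₁+…+a_{j+1} }
-- (with 0-indexed elements x), i.e. π_{j+1} in the paper's indexing.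

InBlock : (as : List ℕ) → ℕ → ℕ → Set
InBlock as j x = sum (take j as) ≤ x × x < sum (take (suc j) as)

IsBasis : ∀ {n} → List ℕ → Pair n → Set
IsBasis as I =
  Is2Subset I × (∀ j → j < length as → ¬ (InBlock as j (fst I) × InBlock as j (snd I)))

ε : ∀ {n} → Pair n → Fin n → ℚ
ε (i , j) x with toℕ x Data.Nat.≟ toℕ i | toℕ x Data.Nat.≟ toℕ j
... | Relation.Nullary.yes _ | _ = 1ℚ
... | Relation.Nullary.no _ | Relation.Nullary.yes _ = 1ℚ
... | Relation.Nullary.no _ | Relation.Nullary.no _ = 0ℚ

coeffSum : ∀ {A : Set} (L : List A) → (Fin (length L) → ℚ) → ℚ
coeffSum [] c = 0ℚ
coeffSum (_ ∷ L) c = c Fin.zero + coeffSum L (λ k → c (Fin.suc k))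
  where import Data.Fin as Fin

combo : ∀ {n} (L : List (Pair n)) → (Fin (length L) → ℚ) → Fin n → ℚ
combo [] c x = 0ℚ
combo (I ∷ L) c x = c Fin.zero * ε I x + combo L (λ k → c (Fin.suc k)) x
  where import Data.Fin as Fin

AffIndep : ∀ {n} → List (Pair n) → Set
AffIndep L = ∀ (c : Fin (length L) → ℚ) →
  coeffSum L c ≡ 0ℚ → (∀ x → combo L c x ≡ 0ℚ) → ∀ k → c k ≡ 0ℚ

HasDim : (n : ℕ) → List ℕ → ℕ → Set
HasDim n as d =
  (∃[ L ] (All (IsBasis {n} as) L × length L ≡ suc d × AffIndep L)) ×
  (∀ (L : List (Pair n)) → All (IsBasis as) L → length L ≡ suc (suc d) → ¬ AffIndep L)

IsOrderingOf : ∀ {n} → Pair n → Pair n → ℕ → ℕ → ℕ → ℕ → Set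
IsOrderingOf I J a₁ a₂ a₃ a₄ =
  (a₁ ∷ a₂ ∷ a₃ ∷ a₄ ∷ []) ↭ (fst I ∷ snd I ∷ fst J ∷ snd J ∷ []) ×
  a₁ ≤ a₂ × a₂ ≤ a₃ × a₃ ≤ a₄

-- (I , J) is sorted: I = U(I,J) = {a₁,a₃} and J = V(I,J) = {a₂,a₄}.
-- (Both I, J are stored increasingly and a₁ ≤ a₃, a₂ ≤ a₄, so equality of
-- sets is equality of the increasing ordered pairs.)
SortedPair : ∀ {n} → Pair n → Pair n → Set
SortedPair I J = ∀ a₁ a₂ a₃ a₄ → IsOrderingOf I J a₁ a₂ a₃ a₄ →
  (fst I ≡ a₁ × snd I ≡ a₃) × (fst J ≡ a₂ × snd J ≡ a₄)

SortedCollection : ∀ {n} → List (Pair n) → Set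
SortedCollection = AllPairs SortedPair

IsPairSet : ∀ {n} → List (Pair n) → Set
IsPairSet E = Unique E × All Is2Subset E

-- E is the vertex set (via I ↦ ε_I) of a maximal (d-dimensional) simplex
-- of the triangulation of Δ_{Π,2} induced by Γ_{2,n}: E can be listed as
-- a sorted collection, all its members are bases (the simplex lies in
-- Δ_{Π,2}), and it has d+1 vertices.
IsMaxSimplex : (n : ℕ) → List ℕ → ℕ → List (Pair n) → Set
IsMaxSimplex n as d E =
  IsPairSet E × (∃[ L ] (L ↭ E × SortedCollection L)) ×
  All (IsBasis as) E × length E ≡ suc d

-- Thrackles (graphs on [n] with vertices in convex position, clockwise
-- increasing, edges drawn as chords).

ChordsIntersect : ∀ {n} → Pair n → Pair n → Set
ChordsIntersect (i , j) (k , l) =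
  (toℕ i ≡ toℕ k ⊎ toℕ i ≡ toℕ l ⊎ toℕ j ≡ toℕ k ⊎ toℕ j ≡ toℕ l) ⊎
  (toℕ i < toℕ k × toℕ k < toℕ j × toℕ j < toℕ l) ⊎
  (toℕ k < toℕ i × toℕ i < toℕ l × toℕ l < toℕ j)

IsThrackle : ∀ {n} → List (Pair n) → Set
IsThrackle E = ∀ e f → e ∈ E → f ∈ E → ChordsIntersect e f

IsBasisThrackle : (n : ℕ) → List ℕ → ℕ → List (Pair n) → Set
IsBasisThrackle n as d E =
  IsPairSet E × IsThrackle E × length E ≡ suc d × All (IsBasis as) E

MaxSimplex : (n : ℕ) → List ℕ → ℕ → Set
MaxSimplex n as d = Σ (List (Pair n)) (IsMaxSimplex n as d)

BasisThrackle : (n : ℕ) → List ℕ → ℕ → Set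
BasisThrackle n as d = Σ (List (Pair n)) (IsBasisThrackle n as d)

_≋_ : ∀ {n} → List (Pair n) → List (Pair n) → Set
E ≋ F = ∀ e → (e ∈ E) ⇔ (e ∈ F)

_≈S_ : ∀ {n as d} → MaxSimplex n as d → MaxSimplex n as d → Set
s ≈S t = proj₁ s ≋ proj₁ t

_≈T_ : ∀ {n as d} → BasisThrackle n as d → BasisThrackle n as d → Set
g ≈T h = proj₁ g ≋ proj₁ h

{-# OPTIONS --safe #-}
module Submission where

-- A maximal simplex and a basis thrackle are both given by a set E of d + 1 bases, so the
-- bijection is the identity on E and the content is: E can be listed as a sorted collection iff it is a thrackle.
-- A pair ({i, j}, {k, l}) is sorted exactly when the two pairs interlace, i ≤ k ≤ j ≤ l,
-- and interlaced chords intersect. Conversely, listing the edges of a thrackle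
-- lexicographically makes every earlier edge interlace with every later one.

open import Defs
open import Level using (0ℓ)
open import Data.Nat using (ℕ; _≤_; _<_)
open import Data.Nat.Properties
  using (≤-refl; ≤-reflexive; m≤n⇒m<n∨m≡n; <⇒≤; <⇒≱; ≤-totalOrder; ≤-decTotalOrder)
open import Data.Nat.ListAction using (sum)
import Data.Fin.Properties as Fin
open import Data.List using (List; []; _∷_; length)
open import Data.List.Membership.Propositional using (_∈_)
open import Data.List.Relation.Unary.All using (All) renaming (lookup to All-lookup)
import Data.List.Relation.Unary.All as All
open import Data.List.Relation.Unary.AllPairs using (AllPairs; []; _∷_)
import Data.List.Relation.Unary.AllPairs as AllPairs
open import Data.List.Relation.Unary.Any using (here; there)
open import Data.List.Relation.Unary.Linked using ([-]; _∷_)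
open import Data.List.Relation.Unary.Sorted.TotalOrder using (Sorted)
open import Data.List.Relation.Unary.Sorted.TotalOrder.Properties using (↗↭↗⇒≋; Sorted⇒AllPairs)
open import Data.List.Relation.Binary.Pointwise.Base using ([]; _∷_)
open import Data.List.Relation.Binary.Permutation.Propositional
  using (_↭_; ↭-sym; ↭-trans; ↭-refl; prep; swap; ↭⇒↭ₛ)
open import Data.List.Relation.Binary.Permutation.Propositional.Properties using (∈-resp-↭; ↭-length)
import Data.List.Sort as Sort
open import Data.Product using (∃; ∃-syntax; _×_; _,_; proj₁)
open import Data.Product.Relation.Binary.Lex.NonStrict using (×-decTotalOrder)
open import Data.Sum using (_⊎_; inj₁; inj₂)
open import Relation.Nullary using (contradiction)
open import Relation.Binary.Bundles using (DecTotalOrder)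
open import Relation.Binary.PropositionalEquality using (_≡_; refl; sym; subst)
open import Function.Base using (id; _∘_)
open import Function.Bundles using (mk⇔)
open import Function.Definitions using (Bijective)

Interlaced : ∀ {n} → Pair n → Pair n → Set
Interlaced I J = fst I ≤ fst J × fst J ≤ snd I × snd I ≤ snd J

orderingOf : ∀ {n} (I J : Pair n) → ∃[ a₁ ] ∃[ a₂ ] ∃[ a₃ ] ∃[ a₄ ] IsOrderingOf I J a₁ a₂ a₃ a₄
orderingOf I J = ordering (sort xs) (↭-length (sort-↭ xs)) (sort-↭ xs) (sort-↗ xs)
  where
  open Sort ≤-decTotalOrder using (sort; sort-↭; sort-↗)
  xs : List ℕ
  xs = fst I ∷ snd I ∷ fst J ∷ snd J ∷ []
  ordering : ∀ ys → length ys ≡ 4 → ys ↭ xs → Sorted ≤-totalOrder ys →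
    ∃[ a₁ ] ∃[ a₂ ] ∃[ a₃ ] ∃[ a₄ ] IsOrderingOf I J a₁ a₂ a₃ a₄
  ordering (a₁ ∷ a₂ ∷ a₃ ∷ a₄ ∷ []) refl p (a₁≤a₂ ∷ a₂≤a₃ ∷ a₃≤a₄ ∷ [-]) =
    a₁ , a₂ , a₃ , a₄ , p , a₁≤a₂ , a₂≤a₃ , a₃≤a₄

SortedPair⇒Interlaced : ∀ {n} {I J : Pair n} → SortedPair I J → Interlaced I J
SortedPair⇒Interlaced {I = I} {J} sorted
  with orderingOf I J
... | a₁ , a₂ , a₃ , a₄ , ord@(_ , a₁≤a₂ , a₂≤a₃ , a₃≤a₄)
  with sorted a₁ a₂ a₃ a₄ ord
... | (refl , refl) , (refl , refl) = a₁≤a₂ , a₂≤a₃ , a₃≤a₄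

-- (i, k, j, l) is itself a nondecreasing ordering of I ∪ J, and such orderings are unique.
Interlaced⇒SortedPair : ∀ {n} {I J : Pair n} → Interlaced I J → SortedPair I J
Interlaced⇒SortedPair {I = I} {J} (i≤k , k≤j , j≤l) a₁ a₂ a₃ a₄ (p , a₁≤a₂ , a₂≤a₃ , a₃≤a₄)
  with ↗↭↗⇒≋ ≤-totalOrder (a₁≤a₂ ∷ a₂≤a₃ ∷ a₃≤a₄ ∷ [-]) (i≤k ∷ k≤j ∷ j≤l ∷ [-])
         (↭⇒↭ₛ (↭-trans p (prep (fst I) (swap (snd I) (fst J) ↭-refl))))
... | refl ∷ refl ∷ refl ∷ refl ∷ [] = (refl , refl) , (refl , refl)

ChordsIntersect-refl : ∀ {n} {I : Pair n} → ChordsIntersect I I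
ChordsIntersect-refl = inj₁ (inj₁ refl)

ChordsIntersect-sym : ∀ {n} {I J : Pair n} → ChordsIntersect I J → ChordsIntersect J I
ChordsIntersect-sym (inj₁ (inj₁ i≡k))               = inj₁ (inj₁ (sym i≡k))
ChordsIntersect-sym (inj₁ (inj₂ (inj₁ i≡l)))        = inj₁ (inj₂ (inj₂ (inj₁ (sym i≡l))))
ChordsIntersect-sym (inj₁ (inj₂ (inj₂ (inj₁ j≡k)))) = inj₁ (inj₂ (inj₁ (sym j≡k)))
ChordsIntersect-sym (inj₁ (inj₂ (inj₂ (inj₂ j≡l)))) = inj₁ (inj₂ (inj₂ (inj₂ (sym j≡l))))
ChordsIntersect-sym (inj₂ (inj₁ crossing))          = inj₂ (inj₂ crossing)
ChordsIntersect-sym (inj₂ (inj₂ crossing))          = inj₂ (inj₁ crossing)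

Interlaced⇒ChordsIntersect : ∀ {n} {I J : Pair n} → Interlaced I J → ChordsIntersect I J
Interlaced⇒ChordsIntersect (i≤k , k≤j , j≤l) with m≤n⇒m<n∨m≡n i≤k | m≤n⇒m<n∨m≡n k≤j | m≤n⇒m<n∨m≡n j≤l
... | inj₂ i≡k | _        | _        = inj₁ (inj₁ i≡k)
... | inj₁ _   | inj₂ k≡j | _        = inj₁ (inj₂ (inj₂ (inj₁ (sym k≡j))))
... | inj₁ _   | inj₁ _   | inj₂ j≡l = inj₁ (inj₂ (inj₂ (inj₂ j≡l)))
... | inj₁ i<k | inj₁ k<j | inj₁ j<l = inj₂ (inj₁ (i<k , k<j , j<l))

lexicographic : ℕ → DecTotalOrder 0ℓ 0ℓ 0ℓ
lexicographic n = ×-decTotalOrder (Fin.≤-decTotalOrder n) (Fin.≤-decTotalOrder n)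

module _ {n : ℕ} where
  open DecTotalOrder (lexicographic n) using () renaming (_≤_ to _≤ₗₑₓ_)

  lexOrdered⇒Interlaced : {I J : Pair n} → Is2Subset I → Is2Subset J →
    I ≤ₗₑₓ J → ChordsIntersect I J → Interlaced I J
  lexOrdered⇒Interlaced i<j _ (inj₂ (refl , j≤l)) _ = ≤-refl , <⇒≤ i<j , j≤l
  lexOrdered⇒Interlaced _ _ (inj₁ (_ , i≢k)) (inj₁ (inj₁ i≡k)) =
    contradiction (Fin.toℕ-injective i≡k) i≢k
  lexOrdered⇒Interlaced _ k<l (inj₁ (i≤k , _)) (inj₁ (inj₂ (inj₁ i≡l))) =
    contradiction (subst (_≤ _) i≡l i≤k) (<⇒≱ k<l)
  lexOrdered⇒Interlaced _ k<l (inj₁ (i≤k , _)) (inj₁ (inj₂ (inj₂ (inj₁ j≡k)))) =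
    i≤k , ≤-reflexive (sym j≡k) , <⇒≤ (subst (_< _) (sym j≡k) k<l)
  lexOrdered⇒Interlaced _ k<l (inj₁ (i≤k , _)) (inj₁ (inj₂ (inj₂ (inj₂ j≡l)))) =
    i≤k , <⇒≤ (subst (_ <_) (sym j≡l) k<l) , ≤-reflexive j≡l
  lexOrdered⇒Interlaced _ _ (inj₁ (i≤k , _)) (inj₂ (inj₁ (_ , k<j , j<l))) =
    i≤k , <⇒≤ k<j , <⇒≤ j<l
  lexOrdered⇒Interlaced _ _ (inj₁ (i≤k , _)) (inj₂ (inj₂ (k<i , _ , _))) =
    contradiction i≤k (<⇒≱ k<i)

module _ {A : Set} {R : A → A → Set} where

  AllPairs-tabulate : {xs : List A} → (∀ {x y} → x ∈ xs → y ∈ xs → R x y) → AllPairs R xs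
  AllPairs-tabulate {[]}     _ = []
  AllPairs-tabulate {x ∷ xs} R-xs =
    All.tabulate (R-xs (here refl) ∘ there) ∷ AllPairs-tabulate (λ x∈ y∈ → R-xs (there x∈) (there y∈))

  AllPairs-lookup : {xs : List A} → AllPairs R xs → ∀ {x y} → x ∈ xs → y ∈ xs →
    x ≡ y ⊎ R x y ⊎ R y x
  AllPairs-lookup (_   ∷ _)   (here refl) (here refl) = inj₁ refl
  AllPairs-lookup (R-x ∷ _)   (here refl) (there y∈)  = inj₂ (inj₁ (All-lookup R-x y∈))
  AllPairs-lookup (R-y ∷ _)   (there x∈)  (here refl) = inj₂ (inj₂ (All-lookup R-y x∈))
  AllPairs-lookup (_   ∷ R-xs) (there x∈) (there y∈)  = AllPairs-lookup R-xs x∈ y∈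

SortedCollection⇒IsThrackle : ∀ {n} {L : List (Pair n)} → SortedCollection L → IsThrackle L
SortedCollection⇒IsThrackle sorted e f e∈ f∈ with AllPairs-lookup sorted e∈ f∈
... | inj₁ refl      = ChordsIntersect-refl
... | inj₂ (inj₁ ef) = Interlaced⇒ChordsIntersect (SortedPair⇒Interlaced ef)
... | inj₂ (inj₂ fe) = ChordsIntersect-sym (Interlaced⇒ChordsIntersect (SortedPair⇒Interlaced fe))

IsThrackle-resp-↭ : ∀ {n} {L E : List (Pair n)} → L ↭ E → IsThrackle L → IsThrackle E
IsThrackle-resp-↭ L↭E thrackle e f e∈ f∈ =
  thrackle e f (∈-resp-↭ (↭-sym L↭E) e∈) (∈-resp-↭ (↭-sym L↭E) f∈)

IsThrackle⇒sortable : ∀ {n} {E : List (Pair n)} → All Is2Subset E → IsThrackle E →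
  ∃[ L ] (L ↭ E × SortedCollection L)
IsThrackle⇒sortable {n} {E} 2subsets thrackle =
  sort E , sort-↭ E ,
  AllPairs.zipWith sortedPair (Sorted⇒AllPairs totalOrder (sort-↗ E) , AllPairs-tabulate intersecting)
  where
  open DecTotalOrder (lexicographic n) using (totalOrder) renaming (_≤_ to _≤ₗₑₓ_)
  open Sort (lexicographic n) using (sort; sort-↭; sort-↗)

  Intersecting2Subsets : Pair n → Pair n → Set
  Intersecting2Subsets I J = Is2Subset I × Is2Subset J × ChordsIntersect I J

  intersecting : ∀ {I J} → I ∈ sort E → J ∈ sort E → Intersecting2Subsets I J
  intersecting {I} {J} I∈ J∈ = All-lookup 2subsets I∈E , All-lookup 2subsets J∈E , thrackle I J I∈E J∈E
    where
    I∈E : I ∈ E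
    I∈E = ∈-resp-↭ (sort-↭ E) I∈
    J∈E : J ∈ E
    J∈E = ∈-resp-↭ (sort-↭ E) J∈

  sortedPair : ∀ {I J} → I ≤ₗₑₓ J × Intersecting2Subsets I J → SortedPair I J
  sortedPair (I≤J , I-2subset , J-2subset , I∩J) =
    Interlaced⇒SortedPair (lexOrdered⇒Interlaced I-2subset J-2subset I≤J I∩J)

maxSimplex⇒basisThrackle : ∀ {n as d} {E : List (Pair n)} → IsMaxSimplex n as d E → IsBasisThrackle n as d E
maxSimplex⇒basisThrackle (pairSet , (L , L↭E , sorted) , bases , size) =
  pairSet , IsThrackle-resp-↭ L↭E (SortedCollection⇒IsThrackle sorted) , size , bases

basisThrackle⇒maxSimplex : ∀ {n as d} {E : List (Pair n)} → IsBasisThrackle n as d E → IsMaxSimplex n as d E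
basisThrackle⇒maxSimplex (pairSet@(_ , 2subsets) , thrackle , size , bases) =
  pairSet , IsThrackle⇒sortable 2subsets thrackle , bases , size

proposition5p2 : (n : ℕ) (as : List ℕ) → All (λ a → 0 < a) as → sum as ≡ n →
    (d : ℕ) → HasDim n as d →
    ∃[ f ] ((∀ (s : MaxSimplex n as d) → proj₁ (f s) ≋ proj₁ s) ×
    Bijective (_≈S_ {n} {as} {d}) (_≈T_ {n} {as} {d}) f)
proposition5p2 n as _ _ d _ =
  graph , (λ _ _ → mk⇔ id id) , id , (λ t → simplex t , id)
  where
  graph : MaxSimplex n as d → BasisThrackle n as d
  graph (E , s) = E , maxSimplex⇒basisThrackle s
  simplex : BasisThrackle n as d → MaxSimplex n as d
  simplex (E , t) = E , basisThrackle⇒maxSimplex t
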